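{- For $p=021$, we have $$C_p(x,y)=\frac{1-4x+6x^2-x^2y-4x^3+3x^3y+x^4-x^4y}{(1-x)(1-2x)(1-2x+x^2-x^2y)}.$$
   Context: A Catalan word of length $n\geq 1$ is a word $w_1\ldots w_n$ over the non-negative integers with $w_1=0$ and $0\leq w_i\leq w_{i-1}+1$ for $2\leq i\leq n$; the empty word is the unique Catalan word of length $0$. A word $w$ contains the pattern $p=p_1\ldots p_k$ if there are indices $i_1<\cdots<i_k$ such that $w_{i_1}\ldots w_{i_k}$ is order-isomorphic to $p$ (for all $a,b$: $w_{i_a}<w_{i_b}$ iff $p_a<p_b$, and $w_{i_a}=w_{i_b}$ iff $p_a=p_b$); otherwise $w$ avoids $p$. $\mathcal{C}_n(p)$ is the set of Catalan words of length $n$ avoiding $p$. A descent of $w$ is an index $i$ with $w_i>w_{i+1}$. $C_p(x,y)=\sum_{n,k\geq 0}c_{n,k}x^ny^k$, where $c_{n,k}$ is the number of words in $\mathcal{C}_n(p)$ with exactly $k$ descents. -}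

module Defs where

open import Data.Bool using (Bool; true; false; _∧_; if_then_else_)
open import Data.Nat using (ℕ; zero; suc; _+_; _∸_; _≡ᵇ_; _≤ᵇ_; _<ᵇ_)
open import Data.List using (List; []; _∷_; _++_; map; concatMap; upTo; length; filterᵇ; zip; foldr)
open import Data.Bool.ListAction using (all; any)
open import Data.Product using (_×_; _,_)
open import Data.Integer using (ℤ) renaming (_+_ to _+ℤ_; _*_ to _*ℤ_)
import Data.Integer as ℤ

data Cmp : Set where
  lt eq gt : Cmp

cmp : ℕ → ℕ → Cmp
cmp zero    zero    = eq
cmp zero    (suc _) = lt
cmp (suc _) zero    = gt
cmp (suc m) (suc n) = cmp m n

_==c_ : Cmp → Cmp → Bool
lt ==c lt = true
eq ==c eq = true
gt ==c gt = true
_  ==c _  = false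

-- u and p are order-isomorphic: same length and for all a < b,
-- u_a vs u_b compares exactly as p_a vs p_b (the case a > b is symmetric,
-- the case a = b trivial).
orderIso : List ℕ → List ℕ → Bool
orderIso []       []       = true
orderIso (a ∷ as) (b ∷ bs) =
  all (λ { (x , y) → cmp a x ==c cmp b y }) (zip as bs) ∧ orderIso as bs
orderIso _        _        = false

subseqs : List ℕ → List (List ℕ)
subseqs []       = [] ∷ []
subseqs (x ∷ xs) = map (x ∷_) (subseqs xs) ++ subseqs xs

contains : List ℕ → List ℕ → Bool
contains w p = any (λ s → orderIso s p) (subseqs w)

avoids : List ℕ → List ℕ → Bool
avoids w p = if contains w p then false else true

catSteps : ℕ → List ℕ → Bool
catSteps prev []       = true
catSteps prev (y ∷ ys) = (y ≤ᵇ suc prev) ∧ catSteps y ys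

isCatalan : List ℕ → Bool
isCatalan []       = true
isCatalan (x ∷ xs) = (x ≡ᵇ 0) ∧ catSteps x xs

descents : List ℕ → ℕ
descents (x ∷ y ∷ ys) = (if y <ᵇ x then 1 else 0) + descents (y ∷ ys)
descents _            = 0

allWords : ℕ → ℕ → List (List ℕ)
allWords b zero    = [] ∷ []
allWords b (suc l) = concatMap (λ v → map (v ∷_) (allWords b l)) (upTo b)

-- c_{n,k}(p): number of Catalan words of length n avoiding p with exactly
-- k descents.  Every Catalan word of length n has entries w_i ≤ i-1 < n,
-- so all such words occur among allWords n n.
cnk : List ℕ → ℕ → ℕ → ℕ
cnk p n k = length (filterᵇ (λ w → isCatalan w ∧ avoids w p ∧ (descents w ≡ᵇ k))
                            (allWords n n))

-- Formal power series in x, y with integer coefficients,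
-- given by their coefficient function: f n k = [x^n y^k] f.

Series : Set
Series = ℕ → ℕ → ℤ

Cgf : List ℕ → Series
Cgf p n k = ℤ.+ (cnk p n k)

sumTo : ℕ → (ℕ → ℤ) → ℤ
sumTo zero    f = f 0
sumTo (suc n) f = f (suc n) +ℤ sumTo n f

_⊛_ : Series → Series → Series
(f ⊛ g) n k = sumTo n (λ i → sumTo k (λ j → f i j *ℤ g (n ∸ i) (k ∸ j)))

-- polynomial given as a list of monomials (coefficient , x-exponent , y-exponent)
poly : List (ℤ × ℕ × ℕ) → Series
poly ms n k = foldr (λ { (c , a , b) r →
                 (if (a ≡ᵇ n) ∧ (b ≡ᵇ k) then c else ℤ.+ 0) +ℤ r }) (ℤ.+ 0) ms

Numer021 : Series
Numer021 = poly ( (ℤ.+ 1 , 0 , 0) ∷ (ℤ.- ℤ.+ 4 , 1 , 0) ∷ (ℤ.+ 6 , 2 , 0)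
                ∷ (ℤ.- ℤ.+ 1 , 2 , 1) ∷ (ℤ.- ℤ.+ 4 , 3 , 0) ∷ (ℤ.+ 3 , 3 , 1)
                ∷ (ℤ.+ 1 , 4 , 0) ∷ (ℤ.- ℤ.+ 1 , 4 , 1) ∷ [])

Denom021 : Series
Denom021 = (poly ((ℤ.+ 1 , 0 , 0) ∷ (ℤ.- ℤ.+ 1 , 1 , 0) ∷ []) ⊛
            poly ((ℤ.+ 1 , 0 , 0) ∷ (ℤ.- ℤ.+ 2 , 1 , 0) ∷ []))
         ⊛ poly ((ℤ.+ 1 , 0 , 0) ∷ (ℤ.- ℤ.+ 2 , 1 , 0) ∷ (ℤ.+ 1 , 2 , 0)
                ∷ (ℤ.- ℤ.+ 1 , 2 , 1) ∷ [])

p021 : List ℕ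
p021 = 0 ∷ 2 ∷ 1 ∷ []

-- A Catalan word starts with 0, and an occurrence x < b < a of 021 can always use that first 0
-- instead of x.  Hence the word avoids 021 iff no letter lies strictly between 0 and the maximum
-- of the letters before it, and reading the word from left to right only the last letter p and
-- the maximum m matter.  The reachable states are (0,1), (1,1), (q,q) for q ≥ 2, and (0,q) for
-- q ≥ 2, from which only zeros can follow.  Counting words by length and descents along these
-- transitions gives linear recurrences, and the denominator (1-x)(1-2x)(1-2x+x²-x²y) is the
-- product of the three recurrence operators; multiplying by it leaves only the initial terms.

module Submission where

open import Defs
open import Data.Bool using (Bool; true; false; _∧_; _∨_; not; T; if_then_else_)
open import Data.Bool.Properties using (∨-assoc; ∨-comm; ∨-identityʳ; ∧-zeroʳ; ∧-distribˡ-∨; T-∨; T-∧; T-≡; T-not-≡)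
open import Data.Bool.ListAction using (any; all)
open import Data.Bool.Solver using (module ∨-∧-Solver)
open import Data.Empty using (⊥-elim)
open import Data.List using (List; []; _∷_; _++_; map; length; filterᵇ; concatMap; applyUpTo; upTo)
open import Data.List.Properties using (filter-++; length-++; map-applyUpTo)
open import Data.Nat.ListAction using (sum)
open import Data.Nat using (ℕ; zero; suc; _+_; _⊔_; _<ᵇ_; _≤ᵇ_; _≡ᵇ_; _<_; _≤_; _≤′_; ≤′-refl; ≤′-step; _⊓_; _∸_; _<?_; z≤n; z<s; s<s; s≤s)
open import Data.Nat.Properties
  using (⊔-identityʳ; +-identityʳ; +-assoc; +-suc; <⇒≱; ≤ᵇ⇒≤; <ᵇ⇒<; m≤n⇒∃[o]m+o≡n; ≤-trans; ≤-reflexive; m≤m+n; m≤n+m; +-monoˡ-≤;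
         +-comm; <⇒<ᵇ; ≤⇒≤ᵇ; n≤1+n; ≤-refl; ⊔-idem; m≤n⇒m⊔n≡n;
         m≤n⇒m≤1+n; ≤′⇒≤; ≤⇒≤′; ≤-total; m≤n⇒m⊓n≡m; m≥n⇒m⊓n≡n; ≮⇒≥)
open import Data.Product using (_,_; proj₂)
open import Data.Sum using (_⊎_; inj₁; inj₂)
open import Data.Integer using (ℤ) renaming (_+_ to _+ℤ_; _-_ to _-ℤ_; _*_ to _*ℤ_)
import Data.Integer as ℤ
import Data.Integer.Properties as ℤₚ
open import Data.Integer.Tactic.RingSolver using () renaming (solve-∀ to ℤ-solve-∀; solve to ℤ-solve)
open import Data.Nat.Tactic.RingSolver using (solve-∀)
open import Function using (_∘_; id; Equivalence)
open import Relation.Binary.PropositionalEquality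
open import Relation.Nullary using (¬_; yes; no)
open import Relation.Nullary.Decidable using (T?)

-- Occurrences of 021

any-++ : {A : Set} (f : A → Bool) (xs ys : List A) → any f (xs ++ ys) ≡ any f xs ∨ any f ys
any-++ f []       ys = refl
any-++ f (x ∷ xs) ys = trans (cong (f x ∨_) (any-++ f xs ys)) (sym (∨-assoc (f x) _ _))

any-map : {A B : Set} (f : B → Bool) (g : A → B) (xs : List A) → any f (map g xs) ≡ any (f ∘ g) xs
any-map f g []       = refl
any-map f g (x ∷ xs) = cong (f (g x) ∨_) (any-map f g xs)

any-mono : {A : Set} {f g : A → Bool} → (∀ x → T (f x) → T (g x)) → ∀ xs → T (any f xs) → T (any g xs)
any-mono f⇒g (x ∷ xs) h with Equivalence.to T-∨ h
... | inj₁ fx   = Equivalence.from T-∨ (inj₁ (f⇒g x fx))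
... | inj₂ rest = Equivalence.from T-∨ (inj₂ (any-mono f⇒g xs rest))

∨-absorbed : ∀ {a b} → (T a → T b) → a ∨ b ≡ b
∨-absorbed {false}          a⇒b = refl
∨-absorbed {true}  {true}   a⇒b = refl
∨-absorbed {true}  {false}  a⇒b = ⊥-elim (a⇒b _)

∨-interchange : ∀ a b c d → (a ∨ b) ∨ (c ∨ d) ≡ (a ∨ c) ∨ (b ∨ d)
∨-interchange = solve 4 (λ a b c d → (a :+ b) :+ (c :+ d) := (a :+ c) :+ (b :+ d)) refl
  where open ∨-∧-Solver

any-subseqs-∷ : (f : List ℕ → Bool) (x : ℕ) (xs : List ℕ) →
                any f (subseqs (x ∷ xs)) ≡ any (f ∘ (x ∷_)) (subseqs xs) ∨ any f (subseqs xs)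
any-subseqs-∷ f x xs = trans (any-++ f (map (x ∷_) (subseqs xs)) (subseqs xs))
                             (cong (_∨ any f (subseqs xs)) (any-map f (x ∷_) (subseqs xs)))

any-subseqs-[] : (f : List ℕ → Bool) → (∀ y ys → f (y ∷ ys) ≡ false) → ∀ xs → any f (subseqs xs) ≡ f []
any-subseqs-[] f never []       = ∨-identityʳ (f [])
any-subseqs-[] f never (x ∷ xs) =
  trans (any-subseqs-∷ f x xs)
        (trans (cong (_∨ any f (subseqs xs)) (any-none (subseqs xs)))
               (any-subseqs-[] f never xs))
  where
  any-none : ∀ yss → any (f ∘ (x ∷_)) yss ≡ false
  any-none []         = refl
  any-none (ys ∷ yss) rewrite never x ys = any-none yss

cmp-lt : ∀ x y → (cmp x y ==c lt) ≡ (x <ᵇ y)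
cmp-lt zero    zero    = refl
cmp-lt zero    (suc y) = refl
cmp-lt (suc x) zero    = refl
cmp-lt (suc x) (suc y) = cmp-lt x y

cmp-gt : ∀ x y → (cmp x y ==c gt) ≡ (y <ᵇ x)
cmp-gt zero    zero    = refl
cmp-gt zero    (suc y) = refl
cmp-gt (suc x) zero    = refl
cmp-gt (suc x) (suc y) = cmp-gt x y

orderIso-length : ∀ s q → ¬ length s ≡ length q → orderIso s q ≡ false
orderIso-length []      []      ≢ = ⊥-elim (≢ refl)
orderIso-length []      (_ ∷ _) ≢ = refl
orderIso-length (_ ∷ _) []      ≢ = refl
orderIso-length (a ∷ s) (b ∷ q) ≢ rewrite orderIso-length s q (≢ ∘ cong suc) = ∧-zeroʳ _

between : ℕ → ℕ → ℕ → Bool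
between x a b = (x <ᵇ b) ∧ (b <ᵇ a)

orderIso-021 : ∀ x a b → orderIso (x ∷ a ∷ b ∷ []) p021 ≡ (x <ᵇ a) ∧ between x a b
orderIso-021 x a b rewrite cmp-lt x a | cmp-lt x b | cmp-gt a b with x <ᵇ a | x <ᵇ b | b <ᵇ a
... | false | _     | _     = refl
... | true  | false | _     = refl
... | true  | true  | false = refl
... | true  | true  | true  = refl

occurs021After : ℕ → List ℕ → Bool
occurs021After x []      = false
occurs021After x (a ∷ w) = ((x <ᵇ a) ∧ any (between x a) w) ∨ occurs021After x w

has021 : List ℕ → Bool
has021 []      = false
has021 (x ∷ w) = occurs021After x w ∨ has021 w

contains-021-from : ∀ x a w → any (λ s → orderIso (x ∷ a ∷ s) p021) (subseqs w) ≡ (x <ᵇ a) ∧ any (between x a) w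
contains-021-from x a []      = trans (∨-identityʳ _)
  (trans (orderIso-length (x ∷ a ∷ []) p021 (λ ())) (sym (∧-zeroʳ _)))
contains-021-from x a (b ∷ w)
  rewrite any-subseqs-∷ (λ s → orderIso (x ∷ a ∷ s) p021) b w
        | any-subseqs-[] (λ s → orderIso (x ∷ a ∷ b ∷ s) p021)
                         (λ y ys → orderIso-length (x ∷ a ∷ b ∷ y ∷ ys) p021 (λ ())) w
        | orderIso-021 x a b | contains-021-from x a w with x <ᵇ a
... | true  = refl
... | false = refl

contains-021-after : ∀ x w → any (λ s → orderIso (x ∷ s) p021) (subseqs w) ≡ occurs021After x w
contains-021-after x []      = refl
contains-021-after x (a ∷ w) rewrite any-subseqs-∷ (λ s → orderIso (x ∷ s) p021) a w
                                   | contains-021-from x a w | contains-021-after x w = refl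

contains-021 : ∀ w → contains w p021 ≡ has021 w
contains-021 []      = refl
contains-021 (x ∷ w) rewrite any-subseqs-∷ (λ s → orderIso s p021) x w
                           | contains-021-after x w = cong (occurs021After x w ∨_) (contains-021 w)

-- Avoidance for words starting with 0

<ᵇ-⊔ : ∀ b m v → (b <ᵇ m ⊔ v) ≡ (b <ᵇ m) ∨ (b <ᵇ v)
<ᵇ-⊔ b       zero    v       = refl
<ᵇ-⊔ b       (suc m) zero    = sym (∨-identityʳ _)
<ᵇ-⊔ zero    (suc m) (suc v) = refl
<ᵇ-⊔ (suc b) (suc m) (suc v) = <ᵇ-⊔ b m v

any-between-⊔ : ∀ x m v w → any (between x (m ⊔ v)) w ≡ any (between x m) w ∨ any (between x v) w
any-between-⊔ x m v []      = refl
any-between-⊔ x m v (b ∷ w) =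
  trans (cong₂ _∨_ (trans (cong ((x <ᵇ b) ∧_) (<ᵇ-⊔ b m v)) (∧-distribˡ-∨ (x <ᵇ b) _ _))
                   (any-between-⊔ x m v w))
        (∨-interchange (between x m b) (between x v b) _ _)

any-between-0 : ∀ x w → any (between x 0) w ≡ false
any-between-0 x []      = refl
any-between-0 x (b ∷ w) rewrite ∧-zeroʳ (x <ᵇ b) = any-between-0 x w

between-from-0 : ∀ x a b → T (between x a b) → T (between 0 a b)
between-from-0 x a (suc b) h = proj₂ (Equivalence.to T-∧ h)

occurs021After⇒occurs021After0 : ∀ x w → T (occurs021After x w) → T (occurs021After 0 w)
occurs021After⇒occurs021After0 x (a ∷ w) h with Equivalence.to T-∨ h
occurs021After⇒occurs021After0 x (suc a ∷ w) h | inj₁ here =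
  Equivalence.from T-∨ (inj₁ (any-mono (between-from-0 x (suc a)) w (proj₂ (Equivalence.to T-∧ here))))
occurs021After⇒occurs021After0 x (zero ∷ w)  h | inj₁ ()
... | inj₂ later = Equivalence.from T-∨ (inj₂ (occurs021After⇒occurs021After0 x w later))

has021⇒occurs021After0 : ∀ w → T (has021 w) → T (occurs021After 0 w)
has021⇒occurs021After0 (x ∷ w) h with Equivalence.to T-∨ h
... | inj₁ here  = Equivalence.from T-∨ (inj₂ (occurs021After⇒occurs021After0 x w here))
... | inj₂ later = Equivalence.from T-∨ (inj₂ (has021⇒occurs021After0 w later))

intrudes : ℕ → List ℕ → Bool
intrudes m []      = false
intrudes m (v ∷ w) = between 0 m v ∨ intrudes (m ⊔ v) w

occurs021After0-intrudes : ∀ m w → occurs021After 0 w ∨ any (between 0 m) w ≡ intrudes m w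
occurs021After0-intrudes m []            = refl
occurs021After0-intrudes m (zero ∷ w)    rewrite ⊔-identityʳ m = occurs021After0-intrudes m w
occurs021After0-intrudes m (suc v ∷ w)   =
  trans (rearrange (any (between 0 (suc v)) w) (occurs021After 0 w) (between 0 m (suc v)) (any (between 0 m) w))
        (cong (between 0 m (suc v) ∨_)
              (trans (cong (occurs021After 0 w ∨_) (sym (any-between-⊔ 0 m (suc v) w)))
                     (occurs021After0-intrudes (m ⊔ suc v) w)))
  where
  open ∨-∧-Solver
  rearrange : ∀ a b c d → (a ∨ b) ∨ (c ∨ d) ≡ c ∨ (b ∨ (d ∨ a))
  rearrange = solve 4 (λ a b c d → (a :+ b) :+ (c :+ d) := c :+ (b :+ (d :+ a))) refl

has021-0∷ : ∀ w → has021 (0 ∷ w) ≡ intrudes 0 w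
has021-0∷ w = begin
  occurs021After 0 w ∨ has021 w                   ≡⟨ ∨-comm (occurs021After 0 w) _ ⟩
  has021 w ∨ occurs021After 0 w                   ≡⟨ ∨-absorbed (has021⇒occurs021After0 w) ⟩
  occurs021After 0 w                              ≡⟨ sym (∨-identityʳ _) ⟩
  occurs021After 0 w ∨ false                      ≡⟨ cong (occurs021After 0 w ∨_) (sym (any-between-0 0 w)) ⟩
  occurs021After 0 w ∨ any (between 0 0) w        ≡⟨ occurs021After0-intrudes 0 w ⟩
  intrudes 0 w                                    ∎
  where open ≡-Reasoning

intrudes-0-1 : ∀ w → intrudes 0 w ≡ intrudes 1 w
intrudes-0-1 []          = refl
intrudes-0-1 (zero ∷ w)  = intrudes-0-1 w
intrudes-0-1 (suc v ∷ w) = refl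

-- w continues a 021-avoiding Catalan prefix with last letter p and maximum m, creating exactly
-- k descents (including a descent from p to the first letter of w).
Good : ℕ → ℕ → ℕ → List ℕ → Bool
Good p m k w = catSteps p w ∧ not (intrudes m w) ∧ (descents (p ∷ w) ≡ᵇ k)

module _ (p m v : ℕ) (w : List ℕ) where

  good-step : ∀ {k m'} → T (v ≤ᵇ suc p) → T (not (between 0 m v)) → T (not (v <ᵇ p)) → m ⊔ v ≡ m' →
              Good p m k (v ∷ w) ≡ Good v m' k w
  good-step step fresh ascent refl
    rewrite Equivalence.to T-≡ step | Equivalence.to T-not-≡ fresh | Equivalence.to T-not-≡ ascent = refl

  good-descent : ∀ {k m'} → T (v ≤ᵇ suc p) → T (not (between 0 m v)) → T (v <ᵇ p) → m ⊔ v ≡ m' →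
                 Good p m (suc k) (v ∷ w) ≡ Good v m' k w
  good-descent step fresh descent refl
    rewrite Equivalence.to T-≡ step | Equivalence.to T-not-≡ fresh | Equivalence.to T-≡ descent = refl

  good-descent-0 : T (v <ᵇ p) → Good p m 0 (v ∷ w) ≡ false
  good-descent-0 descent rewrite Equivalence.to T-≡ descent | ∧-zeroʳ (not (intrudes m (v ∷ w))) = ∧-zeroʳ _

  good-jump : ∀ {k} → T (not (v ≤ᵇ suc p)) → Good p m k (v ∷ w) ≡ false
  good-jump jump rewrite Equivalence.to T-not-≡ jump = refl

  good-intrude : ∀ {k} → T (between 0 m v) → Good p m k (v ∷ w) ≡ false
  good-intrude intrusion rewrite Equivalence.to T-≡ intrusion = ∧-zeroʳ _

counted021 : ℕ → List ℕ → Bool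
counted021 k w = isCatalan w ∧ avoids w p021 ∧ (descents w ≡ᵇ k)

counted021-0∷ : ∀ k w → counted021 k (0 ∷ w) ≡ Good 0 1 k w
counted021-0∷ k w rewrite contains-021 (0 ∷ w) | has021-0∷ w | intrudes-0-1 w with intrudes 1 w
... | true  = refl
... | false = refl

-- Counting by last letter and maximum

count : {A : Set} → (A → Bool) → List A → ℕ
count f xs = length (filterᵇ f xs)

count-++ : {A : Set} (f : A → Bool) (xs ys : List A) → count f (xs ++ ys) ≡ count f xs + count f ys
count-++ f xs ys = trans (cong length (filter-++ (T? ∘ f) xs ys)) (length-++ (filterᵇ f xs))

count-map : {A B : Set} (f : B → Bool) (g : A → B) (xs : List A) → count f (map g xs) ≡ count (f ∘ g) xs
count-map f g []       = refl
count-map f g (x ∷ xs) with f (g x)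
... | true  = cong suc (count-map f g xs)
... | false = count-map f g xs

count-cong : {A : Set} {f g : A → Bool} → (∀ x → f x ≡ g x) → ∀ xs → count f xs ≡ count g xs
count-cong f≗g []       = refl
count-cong {g = g} f≗g (x ∷ xs) rewrite f≗g x with g x
... | true  = cong suc (count-cong f≗g xs)
... | false = count-cong f≗g xs

count-none : {A : Set} {f : A → Bool} → (∀ x → f x ≡ false) → ∀ xs → count f xs ≡ 0
count-none never []       = refl
count-none never (x ∷ xs) rewrite never x = count-none never xs

count-allWords-suc : ∀ (f : List ℕ → Bool) b l →
  count f (allWords b (suc l)) ≡ sum (applyUpTo (λ v → count (f ∘ (v ∷_)) (allWords b l)) b)
count-allWords-suc f b l = trans (count-concatMap (upTo b)) (cong sum (map-applyUpTo id _ b))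
  where
  count-concatMap : ∀ vs → count f (concatMap (λ v → map (v ∷_) (allWords b l)) vs)
                         ≡ sum (map (λ v → count (f ∘ (v ∷_)) (allWords b l)) vs)
  count-concatMap []       = refl
  count-concatMap (v ∷ vs) = trans (count-++ f (map (v ∷_) (allWords b l)) _)
                                   (cong₂ _+_ (count-map f (v ∷_) (allWords b l)) (count-concatMap vs))

sum-applyUpTo-cong : ∀ {f g : ℕ → ℕ} → (∀ v → f v ≡ g v) → ∀ n → sum (applyUpTo f n) ≡ sum (applyUpTo g n)
sum-applyUpTo-cong f≗g zero    = refl
sum-applyUpTo-cong f≗g (suc n) = cong₂ _+_ (f≗g 0) (sum-applyUpTo-cong (f≗g ∘ suc) n)

sum-applyUpTo-zero : ∀ {f : ℕ → ℕ} n → (∀ v → v < n → f v ≡ 0) → sum (applyUpTo f n) ≡ 0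
sum-applyUpTo-zero zero    vanish = refl
sum-applyUpTo-zero (suc n) vanish rewrite vanish 0 z<s = sum-applyUpTo-zero n (λ v v<n → vanish (suc v) (s<s v<n))

sum-applyUpTo-+ : ∀ (f : ℕ → ℕ) m n →
  sum (applyUpTo f (m + n)) ≡ sum (applyUpTo f m) + sum (applyUpTo (λ v → f (v + m)) n)
sum-applyUpTo-+ f zero    n = sum-applyUpTo-cong (λ v → cong f (sym (+-identityʳ v))) n
sum-applyUpTo-+ f (suc m) n = begin
  f 0 + sum (applyUpTo (f ∘ suc) (m + n))
    ≡⟨ cong (f 0 +_) (sum-applyUpTo-+ (f ∘ suc) m n) ⟩
  f 0 + (sum (applyUpTo (f ∘ suc) m) + sum (applyUpTo (λ v → f (suc (v + m))) n))
    ≡⟨ sym (+-assoc (f 0) _ _) ⟩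
  f 0 + sum (applyUpTo (f ∘ suc) m) + sum (applyUpTo (λ v → f (suc (v + m))) n)
    ≡⟨ cong ((f 0 + sum (applyUpTo (f ∘ suc) m)) +_) (sum-applyUpTo-cong (λ v → cong f (sym (+-suc v m))) n) ⟩
  f 0 + sum (applyUpTo (f ∘ suc) m) + sum (applyUpTo (λ v → f (v + suc m)) n) ∎
  where open ≡-Reasoning

δ : ℕ → ℕ
δ zero    = 1
δ (suc _) = 0

timesY : (ℕ → ℕ) → ℕ → ℕ
timesY f zero    = 0
timesY f (suc k) = f k

peakWalks : ℕ → ℕ → ℕ
peakWalks zero      = δ
peakWalks (suc l) k = timesY δ k + peakWalks l k + peakWalks l k

mutual
  groundWalks : ℕ → ℕ → ℕ
  groundWalks zero      = δ
  groundWalks (suc l) k = groundWalks l k + oneWalks l k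

  oneWalks : ℕ → ℕ → ℕ
  oneWalks zero      = δ
  oneWalks (suc l) k = timesY (groundWalks l) k + oneWalks l k + peakWalks l k

data State : ℕ → ℕ → Set where
  ground  : State 0 1
  one     : State 1 1
  peak    : ∀ q → State (2 + q) (2 + q)
  trapped : ∀ q → State 0 (2 + q)

walks : ∀ {p m} → State p m → ℕ → ℕ → ℕ
walks ground      = groundWalks
walks one         = oneWalks
walks (peak _)    = peakWalks
walks (trapped _) = λ _ → δ

walks-zero : ∀ {p m} (s : State p m) → walks s 0 ≡ δ
walks-zero ground      = refl
walks-zero one         = refl
walks-zero (peak _)    = refl
walks-zero (trapped _) = refl

T-not-≤ᵇ : ∀ {m n} → n < m → T (not (m ≤ᵇ n))
T-not-≤ᵇ {m} {n} n<m with m ≤ᵇ n in eq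
... | false = _
... | true  = ⊥-elim (<⇒≱ n<m (≤ᵇ⇒≤ m n (subst T (sym eq) _)))

T-not-<ᵇ : ∀ {m n} → n ≤ m → T (not (m <ᵇ n))
T-not-<ᵇ {m} {n} n≤m with m <ᵇ n in eq
... | false = _
... | true  = ⊥-elim (<⇒≱ (<ᵇ⇒< m n (subst T (sym eq) _)) n≤m)

count-good-[] : ∀ p m k → count (Good p m k) ([] ∷ []) ≡ δ k
count-good-[] p m zero    = refl
count-good-[] p m (suc k) = refl

letters-fit : ∀ {p l b} → p + suc l < b → 2 + p ≤ b
letters-fit {p} {l} fits = ≤-trans (s≤s (≤-trans (s≤s (m≤m+n p l)) (≤-reflexive (sym (+-suc p l))))) fits

count-good-∷ : ∀ p m k b l → p + suc l < b →
  count (Good p m k) (allWords b (suc l))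
    ≡ sum (applyUpTo (λ v → count (Good p m k ∘ (v ∷_)) (allWords b l)) (2 + p))
count-good-∷ p m k b l fits with m≤n⇒∃[o]m+o≡n (letters-fit fits)
... | r , refl = begin
  count (Good p m k) (allWords (2 + p + r) (suc l))
    ≡⟨ count-allWords-suc (Good p m k) (2 + p + r) l ⟩
  sum (applyUpTo extend (2 + p + r))
    ≡⟨ sum-applyUpTo-+ extend (2 + p) r ⟩
  sum (applyUpTo extend (2 + p)) + sum (applyUpTo (λ v → extend (v + (2 + p))) r)
    ≡⟨ cong (sum (applyUpTo extend (2 + p)) +_) (sum-applyUpTo-zero r (λ v _ → jumps (v + (2 + p)) (too-high v))) ⟩
  sum (applyUpTo extend (2 + p)) + 0
    ≡⟨ +-identityʳ _ ⟩
  sum (applyUpTo extend (2 + p)) ∎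
  where
  open ≡-Reasoning
  extend : ℕ → ℕ
  extend v = count (Good p m k ∘ (v ∷_)) (allWords (2 + p + r) l)
  jumps : ∀ v → suc p < v → extend v ≡ 0
  jumps v p+1<v = count-none (λ w → good-jump p m v w {k} (T-not-≤ᵇ p+1<v)) (allWords (2 + p + r) l)
  too-high : ∀ v → suc p < v + (2 + p)
  too-high v = m≤n+m (2 + p) v

+-reassoc₃ : ∀ a b c → a + (b + (c + 0)) ≡ a + b + c
+-reassoc₃ a b c = trans (cong (λ z → a + (b + z)) (+-identityʳ c)) (sym (+-assoc a b c))

fits-next : ∀ {p p' l b} → T (p' ≤ᵇ suc p) → p + suc l < b → p' + l < b
fits-next {p} {p'} {l} step fits =
  ≤-trans (s≤s (≤-trans (+-monoˡ-≤ l (≤ᵇ⇒≤ p' (suc p) step)) (≤-reflexive (sym (+-suc p l))))) fits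

module Transitions {p m : ℕ} (b l : ℕ) (fits : p + suc l < b)
  (count-good-l : ∀ {p' m'} (s : State p' m') k → p' + l < b → count (Good p' m' k) (allWords b l) ≡ walks s l k)
  where

  extend : ℕ → ℕ → ℕ
  extend k v = count (Good p m k ∘ (v ∷_)) (allWords b l)

  follow : ∀ {p' m' k k'} (s : State p' m') → T (p' ≤ᵇ suc p) →
           (∀ w → Good p m k (p' ∷ w) ≡ Good p' m' k' w) → extend k p' ≡ walks s l k'
  follow s step same = trans (count-cong same (allWords b l)) (count-good-l s _ (fits-next step fits))

  blocked : ∀ {k} v → (∀ w → Good p m k (v ∷ w) ≡ false) → extend k v ≡ 0
  blocked v never = count-none never (allWords b l)

  descend : ∀ {m'} (s : State 0 m') → T (0 <ᵇ p) → m ⊔ 0 ≡ m' → ∀ k → extend k 0 ≡ timesY (walks s l) k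
  descend s down max zero    = blocked 0 (λ w → good-descent-0 p m 0 w down)
  descend s down max (suc k) = follow s _ (λ w → good-descent p m 0 w _ _ down max)

count-good : ∀ {p m} (s : State p m) l k b → p + l < b → count (Good p m k) (allWords b l) ≡ walks s l k
count-good s zero k b _ = trans (count-good-[] _ _ k) (cong (λ f → f k) (sym (walks-zero s)))
count-good ground (suc l) k b fits = begin
  count (Good 0 1 k) (allWords b (suc l))
    ≡⟨ count-good-∷ 0 1 k b l fits ⟩
  extend k 0 + (extend k 1 + 0)
    ≡⟨ cong₂ (λ x y → x + (y + 0)) (follow ground _ (λ w → good-step 0 1 0 w _ _ _ refl))
                                   (follow one _ (λ w → good-step 0 1 1 w _ _ _ refl)) ⟩
  groundWalks l k + (oneWalks l k + 0)
    ≡⟨ cong (groundWalks l k +_) (+-identityʳ _) ⟩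
  groundWalks (suc l) k ∎
  where
  open ≡-Reasoning
  open Transitions {0} {1} b l fits (λ s k → count-good s l k b)
count-good one (suc l) k b fits = begin
  count (Good 1 1 k) (allWords b (suc l))
    ≡⟨ count-good-∷ 1 1 k b l fits ⟩
  extend k 0 + (extend k 1 + (extend k 2 + 0))
    ≡⟨ cong₂ (λ x y → x + (y + (extend k 2 + 0))) (descend ground _ refl k)
                                                  (follow one _ (λ w → good-step 1 1 1 w _ _ _ refl)) ⟩
  timesY (groundWalks l) k + (oneWalks l k + (extend k 2 + 0))
    ≡⟨ cong (λ z → timesY (groundWalks l) k + (oneWalks l k + (z + 0)))
            (follow (peak 0) _ (λ w → good-step 1 1 2 w _ _ _ refl)) ⟩
  timesY (groundWalks l) k + (oneWalks l k + (peakWalks l k + 0))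
    ≡⟨ +-reassoc₃ (timesY (groundWalks l) k) (oneWalks l k) (peakWalks l k) ⟩
  oneWalks (suc l) k ∎
  where
  open ≡-Reasoning
  open Transitions {1} {1} b l fits (λ s k → count-good s l k b)
count-good (peak q) (suc l) k b fits = begin
  count (Good (2 + q) (2 + q) k) (allWords b (suc l))
    ≡⟨ count-good-∷ (2 + q) (2 + q) k b l fits ⟩
  extend k 0 + sum (applyUpTo (extend k ∘ suc) (3 + q))
    ≡⟨ cong₂ _+_ (descend (trapped q) _ refl k) skip-intrusions ⟩
  timesY δ k + (extend k (2 + q) + (extend k (3 + q) + 0))
    ≡⟨ cong₂ (λ x y → timesY δ k + (x + (y + 0))) stay climb ⟩
  timesY δ k + (peakWalks l k + (peakWalks l k + 0))
    ≡⟨ +-reassoc₃ (timesY δ k) (peakWalks l k) (peakWalks l k) ⟩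
  peakWalks (suc l) k ∎
  where
  open ≡-Reasoning
  open Transitions {2 + q} {2 + q} b l fits (λ s k → count-good s l k b)
  skip-intrusions : sum (applyUpTo (extend k ∘ suc) (3 + q)) ≡ extend k (2 + q) + (extend k (3 + q) + 0)
  skip-intrusions = begin
    sum (applyUpTo (extend k ∘ suc) (2 + suc q))
      ≡⟨ cong (sum ∘ applyUpTo (extend k ∘ suc)) (+-comm 2 (suc q)) ⟩
    sum (applyUpTo (extend k ∘ suc) (suc q + 2))
      ≡⟨ sum-applyUpTo-+ (extend k ∘ suc) (suc q) 2 ⟩
    sum (applyUpTo (extend k ∘ suc) (suc q)) + (extend k (2 + q) + (extend k (3 + q) + 0))
      ≡⟨ cong (_+ (extend k (2 + q) + (extend k (3 + q) + 0))) (sum-applyUpTo-zero (suc q) intrusions) ⟩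
    extend k (2 + q) + (extend k (3 + q) + 0) ∎
    where
    intrusions : ∀ v → v < suc q → extend k (suc v) ≡ 0
    intrusions v v<1+q = blocked {k} (suc v) (λ w → good-intrude (2 + q) (2 + q) (suc v) w {k} (<⇒<ᵇ v<1+q))
  stay : extend k (2 + q) ≡ peakWalks l k
  stay = follow (peak q) step (λ w → good-step (2 + q) (2 + q) (2 + q) w step fresh fresh (⊔-idem (2 + q)))
    where
    step : T (2 + q ≤ᵇ 3 + q)
    step = ≤⇒≤ᵇ (n≤1+n (2 + q))
    fresh : T (not (2 + q <ᵇ 2 + q))
    fresh = T-not-<ᵇ (≤-refl {2 + q})
  climb : extend k (3 + q) ≡ peakWalks l k
  climb = follow (peak (suc q)) step
    (λ w → good-step (2 + q) (2 + q) (3 + q) w step fresh fresh (m≤n⇒m⊔n≡n (n≤1+n (2 + q))))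
    where
    step : T (3 + q ≤ᵇ 3 + q)
    step = ≤⇒≤ᵇ (≤-refl {3 + q})
    fresh : T (not (3 + q <ᵇ 2 + q))
    fresh = T-not-<ᵇ (n≤1+n (2 + q))
count-good (trapped q) (suc l) k b fits = begin
  count (Good 0 (2 + q) k) (allWords b (suc l))
    ≡⟨ count-good-∷ 0 (2 + q) k b l fits ⟩
  extend k 0 + (extend k 1 + 0)
    ≡⟨ cong₂ (λ x y → x + (y + 0)) (follow (trapped q) _ (λ w → good-step 0 (2 + q) 0 w _ _ _ refl))
                                   (blocked {k} 1 (λ w → good-intrude 0 (2 + q) 1 w {k} _)) ⟩
  δ k + 0
    ≡⟨ +-identityʳ _ ⟩
  δ k ∎
  where
  open ≡-Reasoning
  open Transitions {0} {2 + q} b l fits (λ s k → count-good s l k b)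

cnk-021-suc : ∀ l k → cnk p021 (suc l) k ≡ groundWalks l k
cnk-021-suc l k = begin
  count (counted021 k) (allWords (suc l) (suc l))
    ≡⟨ count-allWords-suc (counted021 k) (suc l) l ⟩
  count (counted021 k ∘ (0 ∷_)) (allWords (suc l) l) + sum (applyUpTo nonzero-start l)
    ≡⟨ cong₂ _+_ (count-cong (counted021-0∷ k) (allWords (suc l) l))
                 (sum-applyUpTo-zero l (λ v _ → count-none (λ _ → refl) (allWords (suc l) l))) ⟩
  count (Good 0 1 k) (allWords (suc l) l) + 0
    ≡⟨ +-identityʳ _ ⟩
  count (Good 0 1 k) (allWords (suc l) l)
    ≡⟨ count-good ground l k (suc l) ≤-refl ⟩
  groundWalks l k ∎
  where
  open ≡-Reasoning
  nonzero-start : ℕ → ℕ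
  nonzero-start v = count (counted021 k ∘ (suc v ∷_)) (allWords (suc l) l)

cnk-021-zero : ∀ k → cnk p021 0 k ≡ δ k
cnk-021-zero zero    = refl
cnk-021-zero (suc k) = refl

-- Cauchy products with a polynomial

sumTo-cong : ∀ {f g : ℕ → ℤ} → (∀ i → f i ≡ g i) → ∀ n → sumTo n f ≡ sumTo n g
sumTo-cong f≗g zero    = f≗g 0
sumTo-cong f≗g (suc n) = cong₂ _+ℤ_ (f≗g (suc n)) (sumTo-cong f≗g n)

sumTo-zero : ∀ {f : ℕ → ℤ} n → (∀ i → i ≤ n → f i ≡ ℤ.+ 0) → sumTo n f ≡ ℤ.+ 0
sumTo-zero zero    vanish = vanish 0 z≤n
sumTo-zero (suc n) vanish =
  trans (cong₂ _+ℤ_ (vanish (suc n) ≤-refl) (sumTo-zero n (λ i i≤n → vanish i (m≤n⇒m≤1+n i≤n))))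
        (ℤₚ.+-identityˡ (ℤ.+ 0))

sumTo-cut : ∀ {f : ℕ → ℤ} {c n} → (∀ i → c < i → f i ≡ ℤ.+ 0) → c ≤′ n → sumTo n f ≡ sumTo c f
sumTo-cut vanish ≤′-refl                = refl
sumTo-cut {f} vanish (≤′-step {n} c≤′n) =
  trans (cong₂ _+ℤ_ (vanish (suc n) (s≤s (≤′⇒≤ c≤′n))) (sumTo-cut vanish c≤′n)) (ℤₚ.+-identityˡ _)

sumTo-⊓ : ∀ {f : ℕ → ℤ} c → (∀ i → c < i → f i ≡ ℤ.+ 0) → ∀ n → sumTo n f ≡ sumTo (c ⊓ n) f
sumTo-⊓ {f} c vanish n with ≤-total n c
... | inj₁ n≤c = cong (λ n' → sumTo n' f) (sym (m≥n⇒m⊓n≡n n≤c))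
... | inj₂ c≤n = trans (sumTo-cut vanish (≤⇒≤′ c≤n)) (cong (λ n' → sumTo n' f) (sym (m≤n⇒m⊓n≡m c≤n)))

SupportedIn : Series → ℕ → ℕ → Set
SupportedIn f A B = ∀ a b → A < a ⊎ B < b → f a b ≡ ℤ.+ 0

∸-mono-< : ∀ {i A C a} → i ≤ A → A + C < a → C < a ∸ i
∸-mono-< {zero}  {A}     {C} {a}     _         A+C<a       = ≤-trans (s≤s (m≤n+m C A)) A+C<a
∸-mono-< {suc i} {suc A} {C} {suc a} (s≤s i≤A) (s≤s A+C<a) = ∸-mono-< i≤A A+C<a

⊛-supported : ∀ {f g A B C D} → SupportedIn f A B → SupportedIn g C D → SupportedIn (f ⊛ g) (A + C) (B + D)
⊛-supported {f} {g} {A} {B} {C} {D} f-supp g-supp a b outside =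
  sumTo-zero a (λ i _ → sumTo-zero b (λ j _ → term-vanishes i j outside))
  where
  term-vanishes : ∀ i j → A + C < a ⊎ B + D < b → f i j *ℤ g (a ∸ i) (b ∸ j) ≡ ℤ.+ 0
  term-vanishes i j far with A <? i | B <? j
  term-vanishes i j far        | yes A<i | _       rewrite f-supp i j (inj₁ A<i) = refl
  term-vanishes i j far        | no  _   | yes B<j rewrite f-supp i j (inj₂ B<j) = refl
  term-vanishes i j (inj₁ far) | no  A≮i | no  _
    rewrite g-supp (a ∸ i) (b ∸ j) (inj₁ (∸-mono-< (≮⇒≥ A≮i) far)) = ℤₚ.*-zeroʳ (f i j)
  term-vanishes i j (inj₂ far) | no  _   | no  B≮j
    rewrite g-supp (a ∸ i) (b ∸ j) (inj₂ (∸-mono-< (≮⇒≥ B≮j) far)) = ℤₚ.*-zeroʳ (f i j)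

≡ᵇ-< : ∀ {a n} → a < n → (a ≡ᵇ n) ≡ false
≡ᵇ-< {zero}  {suc n} _         = refl
≡ᵇ-< {suc a} {suc n} (s≤s a<n) = ≡ᵇ-< a<n

poly-supported : ∀ A B ms → T (all (λ { (_ , a , b) → (a ≤ᵇ A) ∧ (b ≤ᵇ B) }) ms) → SupportedIn (poly ms) A B
poly-supported A B []                 _      n k outside = refl
poly-supported A B ((c , a , b) ∷ ms) bounded n k outside
  with Equivalence.to T-∧ bounded
... | within , rest with Equivalence.to T-∧ within
... | a≤A , b≤B = trans (cong (_+ℤ poly ms n k) (monomial-vanishes outside))
                        (trans (ℤₚ.+-identityˡ _) (poly-supported A B ms rest n k outside))
  where
  monomial-vanishes : A < n ⊎ B < k → (if (a ≡ᵇ n) ∧ (b ≡ᵇ k) then c else ℤ.+ 0) ≡ ℤ.+ 0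
  monomial-vanishes (inj₁ A<n) rewrite ≡ᵇ-< (≤-trans (s≤s (≤ᵇ⇒≤ a A a≤A)) A<n) = refl
  monomial-vanishes (inj₂ B<k) rewrite ≡ᵇ-< (≤-trans (s≤s (≤ᵇ⇒≤ b B b≤B)) B<k) | ∧-zeroʳ (a ≡ᵇ n) = refl

Denom021-supported : SupportedIn Denom021 4 1
Denom021-supported =
  ⊛-supported (⊛-supported (poly-supported 1 0 ((ℤ.+ 1 , 0 , 0) ∷ (ℤ.- ℤ.+ 1 , 1 , 0) ∷ []) _)
                           (poly-supported 1 0 ((ℤ.+ 1 , 0 , 0) ∷ (ℤ.- ℤ.+ 2 , 1 , 0) ∷ []) _))
              (poly-supported 2 1 ((ℤ.+ 1 , 0 , 0) ∷ (ℤ.- ℤ.+ 2 , 1 , 0) ∷ (ℤ.+ 1 , 2 , 0) ∷ (ℤ.- ℤ.+ 1 , 2 , 1) ∷ []) _)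

⊛-congʳ : ∀ f {g h : Series} → (∀ n k → g n k ≡ h n k) → ∀ n k → (f ⊛ g) n k ≡ (f ⊛ h) n k
⊛-congʳ f g≗h n k = sumTo-cong (λ i → sumTo-cong (λ j → cong (f i j *ℤ_) (g≗h (n ∸ i) (k ∸ j))) k) n

⊛-truncate : ∀ {f A B} → SupportedIn f A B → ∀ g n k →
  (f ⊛ g) n k ≡ sumTo (A ⊓ n) (λ i → sumTo (B ⊓ k) (λ j → f i j *ℤ g (n ∸ i) (k ∸ j)))
⊛-truncate {f} {A} {B} supported g n k =
  trans (sumTo-⊓ A (λ i A<i → sumTo-zero k (λ j _ → vanishes i j (inj₁ A<i))) n)
        (sumTo-cong (λ i → sumTo-⊓ B (λ j B<j → vanishes i j (inj₂ B<j)) k) (A ⊓ n))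
  where
  vanishes : ∀ i j → A < i ⊎ B < j → f i j *ℤ g (n ∸ i) (k ∸ j) ≡ ℤ.+ 0
  vanishes i j outside rewrite supported i j outside = refl

-- The generating function

C021 : Series
C021 zero    k = ℤ.+ δ k
C021 (suc l) k = ℤ.+ groundWalks l k

Cgf-021 : ∀ n k → Cgf p021 n k ≡ C021 n k
Cgf-021 zero    k = cong ℤ.+_ (cnk-021-zero k)
Cgf-021 (suc l) k = cong ℤ.+_ (cnk-021-suc l k)

groundWalks-recurrenceℕ : ∀ l k → groundWalks (2 + l) k + groundWalks l k
                                ≡ groundWalks (1 + l) k + groundWalks (1 + l) k + timesY (groundWalks l) k + peakWalks l k
groundWalks-recurrenceℕ l k = rearrange (groundWalks l k) (oneWalks l k) (timesY (groundWalks l) k) (peakWalks l k)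
  where
  rearrange : ∀ g o y p → (g + o) + (y + o + p) + g ≡ (g + o) + (g + o) + y + p
  rearrange = solve-∀

groundWalks-recurrence : ∀ l k →
  ℤ.+ groundWalks (2 + l) k ≡ ℤ.+ groundWalks (1 + l) k +ℤ ℤ.+ groundWalks (1 + l) k
                              +ℤ ℤ.+ timesY (groundWalks l) k +ℤ ℤ.+ peakWalks l k -ℤ ℤ.+ groundWalks l k
groundWalks-recurrence l k = begin
  ℤ.+ g₂                                ≡⟨ add-sub (ℤ.+ g₂) (ℤ.+ g₀) ⟩
  ℤ.+ g₂ +ℤ ℤ.+ g₀ -ℤ ℤ.+ g₀           ≡⟨ cong (_-ℤ ℤ.+ g₀) (sym (ℤₚ.pos-+ g₂ g₀)) ⟩
  ℤ.+ (g₂ + g₀) -ℤ ℤ.+ g₀              ≡⟨ cong (λ n → ℤ.+ n -ℤ ℤ.+ g₀) (groundWalks-recurrenceℕ l k) ⟩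
  ℤ.+ (g₁ + g₁ + y + p) -ℤ ℤ.+ g₀      ≡⟨ cong (_-ℤ ℤ.+ g₀) (pos-+₄ g₁ g₁ y p) ⟩
  ℤ.+ g₁ +ℤ ℤ.+ g₁ +ℤ ℤ.+ y +ℤ ℤ.+ p -ℤ ℤ.+ g₀ ∎
  where
  open ≡-Reasoning
  g₀ g₁ g₂ y p : ℕ
  g₀ = groundWalks l k
  g₁ = groundWalks (1 + l) k
  g₂ = groundWalks (2 + l) k
  y  = timesY (groundWalks l) k
  p  = peakWalks l k
  add-sub : ∀ a b → a ≡ a +ℤ b -ℤ b
  add-sub = ℤ-solve-∀
  pos-+₄ : ∀ a b c d → ℤ.+ (a + b + c + d) ≡ ℤ.+ a +ℤ ℤ.+ b +ℤ ℤ.+ c +ℤ ℤ.+ d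
  pos-+₄ a b c d rewrite ℤₚ.pos-+ (a + b + c) d | ℤₚ.pos-+ (a + b) c | ℤₚ.pos-+ a b = refl

peakWalks-recurrence : ∀ l k → ℤ.+ peakWalks (1 + l) k ≡ ℤ.+ timesY δ k +ℤ ℤ.+ peakWalks l k +ℤ ℤ.+ peakWalks l k
peakWalks-recurrence l k rewrite ℤₚ.pos-+ (timesY δ k + peakWalks l k) (peakWalks l k)
                               | ℤₚ.pos-+ (timesY δ k) (peakWalks l k) = refl

-- For n = m + 5 the truncated product Σ_{i ≤ 4, j ≤ 1} [xⁱyʲ]Denom021 · c_{n-i,K-j} is the left-hand
-- side below, with a_j = c_{m+j+1,K}, s_j = c_{m+j+1,K-1} (absent when K = 0) and
-- t_j = peakWalks (j + m) K; the hypotheses are the recurrences of groundWalks and peakWalks.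
annihilation-y⁰ : ∀ a₀ a₁ a₂ a₃ a₄ t₀ t₁ t₂ →
  a₂ ≡ a₁ +ℤ a₁ +ℤ ℤ.+ 0 +ℤ t₀ -ℤ a₀ →
  a₃ ≡ a₂ +ℤ a₂ +ℤ ℤ.+ 0 +ℤ t₁ -ℤ a₁ →
  a₄ ≡ a₃ +ℤ a₃ +ℤ ℤ.+ 0 +ℤ t₂ -ℤ a₂ →
  t₁ ≡ ℤ.+ 0 +ℤ t₀ +ℤ t₀ →
  t₂ ≡ ℤ.+ 0 +ℤ t₁ +ℤ t₁ →
  ℤ.+ 2 *ℤ a₀ +ℤ (ℤ.- ℤ.+ 7 *ℤ a₁ +ℤ (ℤ.+ 9 *ℤ a₂ +ℤ (ℤ.- ℤ.+ 5 *ℤ a₃ +ℤ ℤ.+ 1 *ℤ a₄))) ≡ ℤ.+ 0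
annihilation-y⁰ a₀ a₁ _ _ _ t₀ _ _ refl refl refl refl refl = ℤ-solve (a₀ ∷ a₁ ∷ t₀ ∷ [])

annihilation-yᵏ⁺¹ : ∀ a₀ a₁ a₂ a₃ a₄ s₀ s₁ s₂ s₃ s₄ t₀ t₁ t₂ z →
  a₂ ≡ a₁ +ℤ a₁ +ℤ s₀ +ℤ t₀ -ℤ a₀ →
  a₃ ≡ a₂ +ℤ a₂ +ℤ s₁ +ℤ t₁ -ℤ a₁ →
  a₄ ≡ a₃ +ℤ a₃ +ℤ s₂ +ℤ t₂ -ℤ a₂ →
  t₁ ≡ z +ℤ t₀ +ℤ t₀ →
  t₂ ≡ z +ℤ t₁ +ℤ t₁ →
  (ℤ.- ℤ.+ 2 *ℤ s₀ +ℤ ℤ.+ 2 *ℤ a₀) +ℤ ((ℤ.+ 3 *ℤ s₁ +ℤ ℤ.- ℤ.+ 7 *ℤ a₁) +ℤ ((ℤ.- ℤ.+ 1 *ℤ s₂ +ℤ ℤ.+ 9 *ℤ a₂)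
    +ℤ ((ℤ.+ 0 *ℤ s₃ +ℤ ℤ.- ℤ.+ 5 *ℤ a₃) +ℤ (ℤ.+ 0 *ℤ s₄ +ℤ ℤ.+ 1 *ℤ a₄)))) ≡ ℤ.+ 0
annihilation-yᵏ⁺¹ a₀ a₁ _ _ _ s₀ s₁ s₂ s₃ s₄ t₀ _ _ z refl refl refl refl refl =
  ℤ-solve (a₀ ∷ a₁ ∷ s₀ ∷ s₁ ∷ s₂ ∷ s₃ ∷ s₄ ∷ t₀ ∷ z ∷ [])

Denom021⊛C021-truncated : ℕ → ℕ → ℤ
Denom021⊛C021-truncated n k = sumTo (4 ⊓ n) (λ i → sumTo (1 ⊓ k) (λ j → Denom021 i j *ℤ C021 (n ∸ i) (k ∸ j)))

Denom021⊛C021-truncated≡Numer021 : ∀ n k → Denom021⊛C021-truncated n k ≡ Numer021 n k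
Denom021⊛C021-truncated≡Numer021 (suc (suc (suc (suc (suc m))))) zero =
  annihilation-y⁰ (a 0) (a 1) (a 2) (a 3) (a 4) (t 0) (t 1) (t 2)
    (groundWalks-recurrence m 0) (groundWalks-recurrence (1 + m) 0) (groundWalks-recurrence (2 + m) 0)
    (peakWalks-recurrence m 0) (peakWalks-recurrence (1 + m) 0)
  where
  a t : ℕ → ℤ
  a j = ℤ.+ groundWalks (j + m) 0
  t j = ℤ.+ peakWalks (j + m) 0
Denom021⊛C021-truncated≡Numer021 (suc (suc (suc (suc (suc m))))) (suc k) =
  annihilation-yᵏ⁺¹ (a 0) (a 1) (a 2) (a 3) (a 4) (s 0) (s 1) (s 2) (s 3) (s 4) (t 0) (t 1) (t 2) (ℤ.+ δ k)
    (groundWalks-recurrence m (suc k)) (groundWalks-recurrence (1 + m) (suc k)) (groundWalks-recurrence (2 + m) (suc k))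
    (peakWalks-recurrence m (suc k)) (peakWalks-recurrence (1 + m) (suc k))
  where
  a s t : ℕ → ℤ
  a j = ℤ.+ groundWalks (j + m) (suc k)
  s j = ℤ.+ groundWalks (j + m) k
  t j = ℤ.+ peakWalks (j + m) (suc k)
Denom021⊛C021-truncated≡Numer021 0 zero                = refl
Denom021⊛C021-truncated≡Numer021 0 (suc _)             = refl
Denom021⊛C021-truncated≡Numer021 1 zero                = refl
Denom021⊛C021-truncated≡Numer021 1 (suc _)             = refl
Denom021⊛C021-truncated≡Numer021 2 zero                = refl
Denom021⊛C021-truncated≡Numer021 2 (suc zero)          = refl
Denom021⊛C021-truncated≡Numer021 2 (suc (suc _))       = refl
Denom021⊛C021-truncated≡Numer021 3 zero                = refl
Denom021⊛C021-truncated≡Numer021 3 (suc zero)          = refl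
Denom021⊛C021-truncated≡Numer021 3 (suc (suc _))       = refl
Denom021⊛C021-truncated≡Numer021 4 zero                = refl
Denom021⊛C021-truncated≡Numer021 4 (suc zero)          = refl
Denom021⊛C021-truncated≡Numer021 4 (suc (suc _))       = refl

theorem6 : ∀ n k → (Denom021 ⊛ Cgf p021) n k ≡ Numer021 n k
theorem6 n k = begin
  (Denom021 ⊛ Cgf p021) n k    ≡⟨ ⊛-congʳ Denom021 Cgf-021 n k ⟩
  (Denom021 ⊛ C021) n k        ≡⟨ ⊛-truncate Denom021-supported C021 n k ⟩
  Denom021⊛C021-truncated n k  ≡⟨ Denom021⊛C021-truncated≡Numer021 n k ⟩
  Numer021 n k                 ∎
  where open ≡-Reasoning
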